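{- Let $a\in\mathbb{R}^{+}$ and $c\in(0,1)$, and let $G$ be a graph with $|V(G)|\geq a$. Then $\gamma^{c}(G)\leq a$ if and only if there exists a $c$-self dominating function $f:V(G)\to\{0,1,c\}$ of $G$ with $a-1<w(f)\leq a$.
   Context: For a graph $G$ and $u\in V(G)$, $N_G(u)$ is the set of neighbours of $u$. For $c\in\mathbb{R}^{+}\cup\{\infty\}$, a function $f:V(G)\to\mathbb{R}^{+}\cup\{0,\infty\}$ is a $c$-self dominating function of $G$ if for every $u\in V(G)$, $f(u)\geq c$ or $\max\{f(v):v\in N_G(u)\}\geq 1$. The weight is $w(f)=\sum_{u\in V(G)}f(u)$, and $\gamma^{c}(G)$ is the minimum weight of a $c$-self dominating function of $G$. -}

module Defs where

open import Data.Nat using (ℕ; zero; suc)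
open import Data.Fin using (Fin; zero; suc)
open import Data.Product using (Σ; ∃; _×_; _,_)
open import Data.Sum using (_⊎_)
open import Relation.Nullary using (¬_)
open import Relation.Binary.PropositionalEquality using (_≡_)

-- The real numbers, axiomatised as a complete ordered field
-- (unique up to isomorphism, so quantifying over all models is the
-- same as speaking about ℝ).  x ≤ y is spelled out as x < y ⊎ x ≡ y.

record RealField : Set₁ where
  infixl 6 _+_
  infixl 7 _*_
  infix  4 _<_
  field
    R          : Set
    0# 1#      : R
    _+_ _*_    : R → R → R
    -_         : R → R
    _<_        : R → R → Set
    +-assoc    : ∀ x y z → (x + y) + z ≡ x + (y + z)
    +-comm     : ∀ x y → x + y ≡ y + x
    +-identityˡ : ∀ x → 0# + x ≡ x
    -‿inverseˡ : ∀ x → (- x) + x ≡ 0#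
    *-assoc    : ∀ x y z → (x * y) * z ≡ x * (y * z)
    *-comm     : ∀ x y → x * y ≡ y * x
    *-identityˡ : ∀ x → 1# * x ≡ x
    distribˡ   : ∀ x y z → x * (y + z) ≡ (x * y) + (x * z)
    0≢1        : ¬ (0# ≡ 1#)
    *-inverse  : ∀ x → ¬ (x ≡ 0#) → ∃ λ y → y * x ≡ 1#
    <-irrefl   : ∀ x → ¬ (x < x)
    <-trans    : ∀ {x y z} → x < y → y < z → x < z
    <-trichotomy : ∀ x y → x < y ⊎ x ≡ y ⊎ y < x
    +-monoˡ-<  : ∀ {x y} z → x < y → x + z < y + z
    *-pos      : ∀ {x y} → 0# < x → 0# < y → 0# < x * y
    sup        : (S : R → Set) → (∃ λ x → S x) →
                 (∃ λ b → ∀ x → S x → (x < b ⊎ x ≡ b)) →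
                 ∃ λ s → (∀ x → S x → (x < s ⊎ x ≡ s)) ×
                         (∀ b → (∀ x → S x → (x < b ⊎ x ≡ b)) → (s < b ⊎ s ≡ b))

module _ (ℝ : RealField) where
  open RealField ℝ

  infix 4 _≤_
  _≤_ : R → R → Set
  x ≤ y = x < y ⊎ x ≡ y

  _-_ : R → R → R
  x - y = x + (- y)

  fromℕ : ℕ → R
  fromℕ zero    = 0#
  fromℕ (suc k) = 1# + fromℕ k

  data Ext : Set where
    fin : R → Ext
    ∞   : Ext

  infixl 6 _+ₑ_
  _+ₑ_ : Ext → Ext → Ext
  fin x +ₑ fin y = fin (x + y)
  fin x +ₑ ∞     = ∞
  ∞     +ₑ _     = ∞

  infix 4 _≤ₑ_ _<ₑ_
  data _≤ₑ_ : Ext → Ext → Set where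
    fin≤fin : ∀ {x y} → x ≤ y → fin x ≤ₑ fin y
    ≤∞      : ∀ {e} → e ≤ₑ ∞

  data _<ₑ_ : Ext → Ext → Set where
    fin<fin : ∀ {x y} → x < y → fin x <ₑ fin y
    fin<∞   : ∀ {x} → fin x <ₑ ∞

  sumₑ : (n : ℕ) → (Fin n → Ext) → Ext
  sumₑ zero    f = fin 0#
  sumₑ (suc n) f = f zero +ₑ sumₑ n (λ i → f (suc i))

record Graph : Set₁ where
  field
    n     : ℕ
    Adj   : Fin n → Fin n → Set
    sym   : ∀ {u v} → Adj u v → Adj v u
    irrefl : ∀ {u} → ¬ Adj u u

open Graph public

module _ (ℝ : RealField) where
  open RealField ℝ

  IsAdmissible : (G : Graph) → (Fin (n G) → Ext ℝ) → Set
  IsAdmissible G f = ∀ u → f u ≡ ∞ ⊎ (∃ λ r → f u ≡ fin r × _≤_ ℝ 0# r)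

  weight : (G : Graph) → (Fin (n G) → Ext ℝ) → Ext ℝ
  weight G f = sumₑ ℝ (n G) f

  -- c-self dominating: f(u) ≥ c or max{f(v) : v ∈ N(u)} ≥ 1
  -- (the max over the finite set N(u) is ≥ 1 iff some neighbour has value ≥ 1)
  IsSelfDom : (G : Graph) → (c : R) → (Fin (n G) → Ext ℝ) → Set
  IsSelfDom G c f = ∀ u → _≤ₑ_ ℝ (fin c) (f u)
                        ⊎ (∃ λ v → Adj G u v × _≤ₑ_ ℝ (fin 1#) (f v))

  IsSDF : (G : Graph) → (c : R) → (Fin (n G) → Ext ℝ) → Set
  IsSDF G c f = IsAdmissible G f × IsSelfDom G c f

  IsGammaC : (G : Graph) → (c : R) → Ext ℝ → Set
  IsGammaC G c m = (∃ λ f → IsSDF G c f × weight G f ≡ m)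
                 × (∀ f → IsSDF G c f → _≤ₑ_ ℝ m (weight G f))

  Values01c : (G : Graph) → (c : R) → (Fin (n G) → Ext ℝ) → Set
  Values01c G c f = ∀ u → f u ≡ fin 0# ⊎ f u ≡ fin 1# ⊎ f u ≡ fin c

module Submission where

-- Backward: a c-self dominating f with w(f) ≤ a gives
-- γ^c(G) ≤ w(f) ≤ a.  Forward: take a c-self dominating g of minimum
-- weight γ^c(G) ≤ a.  Its values are finite, so g is real valued.
--   1. Rounding.  Replace every value x by 1 if x ≥ 1, by c if c ≤ x < 1,
--      and by 0 otherwise.  The result h takes values in {0, 1, c}, is
--      still c-self dominating, and w(h) ≤ w(g) ≤ a.
--   2. Raising.  Let hₖ be h with its first k vertices set to 1.  Every hₖ
--      is a {0, 1, c}-valued c-self dominating function, w(h₀) ≤ a,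
--      w(hₙ) = n ≥ a > a - 1, and w(hₖ₊₁) ≤ w(hₖ) + 1 because h ≥ 0.
--   3. A discrete intermediate value theorem: a sequence starting at most
--      a, increasing by at most 1 per step and eventually exceeding a - 1
--      has a term in (a - 1, a].  That term is the required weight.
-- The file first collects facts about ordered fields, real sums and the
-- intermediate value lemma, then the rounding and raising constructions,
-- and finally derives the theorem.

open import Defs
open import Data.Product using (∃; Σ; _×_; _,_; proj₁; proj₂)
open import Data.Sum using (_⊎_; inj₁; inj₂)
open import Data.Empty using (⊥-elim)
open import Data.Nat using (ℕ; zero; suc)
open import Data.Fin using (Fin; zero; suc)
open import Function.Bundles using (_⇔_; mk⇔)
open import Relation.Nullary using (¬_)
open import Relation.Binary.PropositionalEquality
  using (_≡_; refl; trans; cong; cong₂; subst; subst₂) renaming (sym to ≡-sym)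

module OrderedFieldFacts (ℝ : RealField) where
  open RealField ℝ

  infix 4 _≤ᵣ_
  _≤ᵣ_ : R → R → Set
  _≤ᵣ_ = _≤_ ℝ

  ≤-refl : ∀ {x} → x ≤ᵣ x
  ≤-refl = inj₂ refl

  ≤-trans : ∀ {x y z} → x ≤ᵣ y → y ≤ᵣ z → x ≤ᵣ z
  ≤-trans (inj₁ p) (inj₁ q)    = inj₁ (<-trans p q)
  ≤-trans (inj₁ p) (inj₂ refl) = inj₁ p
  ≤-trans (inj₂ refl) q        = q

  <-≤-trans : ∀ {x y z} → x < y → y ≤ᵣ z → x < z
  <-≤-trans p (inj₁ q)    = <-trans p q
  <-≤-trans p (inj₂ refl) = p

  ≤⇒≯ : ∀ {x y} → x ≤ᵣ y → ¬ (y < x)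
  ≤⇒≯ {x} (inj₁ p) q    = <-irrefl x (<-trans p q)
  ≤⇒≯ {x} (inj₂ refl) q = <-irrefl x q

  ≤⊎> : ∀ x y → x ≤ᵣ y ⊎ y < x
  ≤⊎> x y with <-trichotomy x y
  ... | inj₁ p        = inj₁ (inj₁ p)
  ... | inj₂ (inj₁ e) = inj₁ (inj₂ e)
  ... | inj₂ (inj₂ p) = inj₂ p

  +-monoˡ-≤ : ∀ {x y} z → x ≤ᵣ y → x + z ≤ᵣ y + z
  +-monoˡ-≤ z (inj₁ p)    = inj₁ (+-monoˡ-< z p)
  +-monoˡ-≤ z (inj₂ refl) = inj₂ refl

  +-monoʳ-≤ : ∀ {x y} z → x ≤ᵣ y → z + x ≤ᵣ z + y
  +-monoʳ-≤ {x} {y} z p = subst₂ _≤ᵣ_ (+-comm x z) (+-comm y z) (+-monoˡ-≤ z p)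

  +-identityʳ : ∀ x → x + 0# ≡ x
  +-identityʳ x = trans (+-comm x 0#) (+-identityˡ x)

  ∸-+-cancel : ∀ x y → _-_ ℝ x y + y ≡ x
  ∸-+-cancel x y = trans (+-assoc x (- y) y)
                         (trans (cong (x +_) (-‿inverseˡ y)) (+-identityʳ x))

  <-+1 : 0# < 1# → ∀ x → x < x + 1#
  <-+1 0<1 x = subst₂ _<_ (+-identityˡ x) (+-comm 1# x) (+-monoˡ-< x 0<1)

  discrete-ivt : ∀ (b : R) N (s : ℕ → R) → s 0 ≤ᵣ b + 1# →
                 (∀ k → s (suc k) ≤ᵣ s k + 1#) → b < s N →
                 ∃ λ k → b < s k × s k ≤ᵣ b + 1#
  discrete-ivt b zero s s₀≤ step b<sN = 0 , b<sN , s₀≤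
  discrete-ivt b (suc N) s s₀≤ step b<sN with ≤⊎> (s 0) b
  ... | inj₂ b<s₀ = 0 , b<s₀ , s₀≤
  ... | inj₁ s₀≤b with discrete-ivt b N (λ k → s (suc k))
                         (≤-trans (step 0) (+-monoˡ-≤ 1# s₀≤b))
                         (λ k → step (suc k)) b<sN
  ...   | k , b<sₖ , sₖ≤ = suc k , b<sₖ , sₖ≤

  sumR : (m : ℕ) → (Fin m → R) → R
  sumR zero    r = 0#
  sumR (suc m) r = r zero + sumR m (λ i → r (suc i))

  sumR-mono : ∀ m {r r' : Fin m → R} → (∀ u → r u ≤ᵣ r' u) → sumR m r ≤ᵣ sumR m r'
  sumR-mono zero    r≤r' = ≤-refl
  sumR-mono (suc m) {r} {r'} r≤r' =
    ≤-trans (+-monoˡ-≤ (sumR m (λ i → r (suc i))) (r≤r' zero))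
            (+-monoʳ-≤ (r' zero) (sumR-mono m (λ u → r≤r' (suc u))))

  sumₑ-fin : ∀ m {f : Fin m → Ext ℝ} (r : Fin m → R) →
             (∀ u → f u ≡ fin (r u)) → sumₑ ℝ m f ≡ fin (sumR m r)
  sumₑ-fin zero    r f≡r = refl
  sumₑ-fin (suc m) r f≡r =
    cong₂ (_+ₑ_ ℝ) (f≡r zero) (sumₑ-fin m (λ i → r (suc i)) (λ u → f≡r (suc u)))

  sumₑ-∞ : ∀ m (f : Fin m → Ext ℝ) u → f u ≡ ∞ → sumₑ ℝ m f ≡ ∞
  sumₑ-∞ (suc m) f zero    f₀≡∞ rewrite f₀≡∞ = refl
  sumₑ-∞ (suc m) f (suc u) fᵤ≡∞
    rewrite sumₑ-∞ m (λ i → f (suc i)) u fᵤ≡∞ = +∞ (f zero)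
    where
    +∞ : ∀ x → _+ₑ_ ℝ x ∞ ≡ ∞
    +∞ (fin x) = refl
    +∞ ∞       = refl

  fin≤fin⁻¹ : ∀ {x y} → _≤ₑ_ ℝ (fin x) (fin y) → x ≤ᵣ y
  fin≤fin⁻¹ (fin≤fin p) = p

  ≤ₑ-trans : ∀ {x y z : Ext ℝ} → _≤ₑ_ ℝ x y → _≤ₑ_ ℝ y z → _≤ₑ_ ℝ x z
  ≤ₑ-trans (fin≤fin p) (fin≤fin q) = fin≤fin (≤-trans p q)
  ≤ₑ-trans _ ≤∞ = ≤∞

  ∞≰fin : ∀ {x} → ¬ (_≤ₑ_ ℝ ∞ (fin x))
  ∞≰fin ()

  bounded⇒finite : ∀ m {a} (f : Fin m → Ext ℝ) →
    (∀ u → f u ≡ ∞ ⊎ ∃ λ r → f u ≡ fin r × 0# ≤ᵣ r) → _≤ₑ_ ℝ (sumₑ ℝ m f) (fin a) →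
    Σ (Fin m → R) λ r → (∀ u → f u ≡ fin (r u)) × (∀ u → 0# ≤ᵣ r u)
  bounded⇒finite m f adm Σf≤a =
    (λ u → proj₁ (real u)) , (λ u → proj₁ (proj₂ (real u))) , (λ u → proj₂ (proj₂ (real u)))
    where
    real : ∀ u → ∃ λ r → f u ≡ fin r × 0# ≤ᵣ r
    real u with adm u
    ... | inj₂ fᵤ-real = fᵤ-real
    ... | inj₁ fᵤ≡∞ =
      ⊥-elim (∞≰fin (subst (λ w → _≤ₑ_ ℝ w (fin _)) (sumₑ-∞ m f u fᵤ≡∞) Σf≤a))

  raise : ∀ {m} → ℕ → (Fin m → R) → Fin m → R
  raise zero    h u       = h u
  raise (suc k) h zero    = 1#
  raise (suc k) h (suc u) = raise k (λ i → h (suc i)) u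

  raise-cases : ∀ {m} k (h : Fin m → R) u → raise k h u ≡ h u ⊎ raise k h u ≡ 1#
  raise-cases zero    h u       = inj₁ refl
  raise-cases (suc k) h zero    = inj₂ refl
  raise-cases (suc k) h (suc u) = raise-cases k (λ i → h (suc i)) u

  raise-all : ∀ m (h : Fin m → R) → sumR m (raise m h) ≡ fromℕ ℝ m
  raise-all zero    h = refl
  raise-all (suc m) h = cong (1# +_) (raise-all m (λ i → h (suc i)))

  raise-step : 0# < 1# → ∀ m k (h : Fin m → R) → (∀ u → 0# ≤ᵣ h u) →
               sumR m (raise (suc k) h) ≤ᵣ sumR m (raise k h) + 1#
  raise-step 0<1 zero    k h h≥0 = inj₁ (<-+1 0<1 0#)
  raise-step 0<1 (suc m) zero h h≥0 =
    subst (_≤ᵣ (h zero + S) + 1#) 0+S+1≡1+S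
          (+-monoˡ-≤ 1# (+-monoˡ-≤ S (h≥0 zero)))
    where
    S : R
    S = sumR m (λ i → h (suc i))
    0+S+1≡1+S : (0# + S) + 1# ≡ 1# + S
    0+S+1≡1+S = trans (cong (_+ 1#) (+-identityˡ S)) (+-comm S 1#)
  raise-step 0<1 (suc m) (suc k) h h≥0 =
    subst (1# + sumR m (raise (suc k) h') ≤ᵣ_)
          (≡-sym (+-assoc 1# (sumR m (raise k h')) 1#))
          (+-monoʳ-≤ 1# (raise-step 0<1 m k h' (λ u → h≥0 (suc u))))
    where
    h' : Fin m → R
    h' i = h (suc i)

module SelfDomination (ℝ : RealField) (c : RealField.R ℝ)
  (0<c : RealField._<_ ℝ (RealField.0# ℝ) c)
  (c<1 : RealField._<_ ℝ c (RealField.1# ℝ))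
  (G : Graph) where
  open RealField ℝ
  open OrderedFieldFacts ℝ

  0<1 : 0# < 1#
  0<1 = <-trans 0<c c<1

  V : ℕ
  V = n G

  Value01c : R → Set
  Value01c y = y ≡ 0# ⊎ y ≡ 1# ⊎ y ≡ c

  Value01c⇒≥0 : ∀ {y} → Value01c y → 0# ≤ᵣ y
  Value01c⇒≥0 (inj₁ refl)        = ≤-refl
  Value01c⇒≥0 (inj₂ (inj₁ refl)) = inj₁ 0<1
  Value01c⇒≥0 (inj₂ (inj₂ refl)) = inj₁ 0<c

  SelfDom : (Fin V → R) → Set
  SelfDom h = ∀ u → c ≤ᵣ h u ⊎ ∃ λ v → Adj G u v × 1# ≤ᵣ h v

  -- The domination condition only asks for values ≥ c or ≥ 1, so it
  -- survives any change of values preserving those two lower bounds.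
  SelfDom-transfer : ∀ {h h'} → (∀ u → c ≤ᵣ h u → c ≤ᵣ h' u) →
                     (∀ u → 1# ≤ᵣ h u → 1# ≤ᵣ h' u) → SelfDom h → SelfDom h'
  SelfDom-transfer keep-c keep-1 sd u with sd u
  ... | inj₁ c≤hᵤ             = inj₁ (keep-c u c≤hᵤ)
  ... | inj₂ (v , uv , 1≤hᵥ) = inj₂ (v , uv , keep-1 v 1≤hᵥ)

  SelfDom-fromExt : ∀ {g} (r : Fin V → R) → (∀ u → g u ≡ fin (r u)) →
                    IsSelfDom ℝ G c g → SelfDom r
  SelfDom-fromExt {g} r g≡r sd u with sd u
  ... | inj₁ c≤gᵤ = inj₁ (fin≤fin⁻¹ (subst (_≤ₑ_ ℝ (fin c)) (g≡r u) c≤gᵤ))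
  ... | inj₂ (v , uv , 1≤gᵥ) =
    inj₂ (v , uv , fin≤fin⁻¹ (subst (_≤ₑ_ ℝ (fin 1#)) (g≡r v) 1≤gᵥ))

  toSDF : (h : Fin V → R) → (∀ u → Value01c (h u)) → SelfDom h →
          Values01c ℝ G c (λ u → fin (h u)) × IsSDF ℝ G c (λ u → fin (h u))
  toSDF h vals sd = values , admissible , selfDom
    where
    values : Values01c ℝ G c (λ u → fin (h u))
    values u with vals u
    ... | inj₁ e        = inj₁ (cong fin e)
    ... | inj₂ (inj₁ e) = inj₂ (inj₁ (cong fin e))
    ... | inj₂ (inj₂ e) = inj₂ (inj₂ (cong fin e))
    admissible : IsAdmissible ℝ G (λ u → fin (h u))
    admissible u = inj₂ (h u , refl , Value01c⇒≥0 (vals u))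
    selfDom : IsSelfDom ℝ G c (λ u → fin (h u))
    selfDom u with sd u
    ... | inj₁ c≤hᵤ            = inj₁ (fin≤fin c≤hᵤ)
    ... | inj₂ (v , uv , 1≤hᵥ) = inj₂ (v , uv , fin≤fin 1≤hᵥ)

  record RoundsDown (x y : R) : Set where
    field
      value  : Value01c y
      below  : y ≤ᵣ x
      keep-c : c ≤ᵣ x → c ≤ᵣ y
      keep-1 : 1# ≤ᵣ x → 1# ≤ᵣ y

  roundDown : (x : R) → 0# ≤ᵣ x → Σ R (RoundsDown x)
  roundDown x 0≤x with ≤⊎> 1# x
  ... | inj₁ 1≤x = 1# , record
    { value = inj₂ (inj₁ refl) ; below = 1≤x
    ; keep-c = λ _ → inj₁ c<1 ; keep-1 = λ _ → ≤-refl }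
  ... | inj₂ x<1 with ≤⊎> c x
  ...   | inj₁ c≤x = c , record
    { value = inj₂ (inj₂ refl) ; below = c≤x
    ; keep-c = λ _ → ≤-refl ; keep-1 = λ 1≤x → ⊥-elim (≤⇒≯ 1≤x x<1) }
  ...   | inj₂ x<c = 0# , record
    { value = inj₁ refl ; below = 0≤x
    ; keep-c = λ c≤x → ⊥-elim (≤⇒≯ c≤x x<c)
    ; keep-1 = λ 1≤x → ⊥-elim (≤⇒≯ 1≤x x<1) }

  round-SelfDom : ∀ {a} (r : Fin V → R) → (∀ u → 0# ≤ᵣ r u) → SelfDom r →
    sumR V r ≤ᵣ a →
    Σ (Fin V → R) λ h → (∀ u → Value01c (h u)) × SelfDom h × sumR V h ≤ᵣ a
  round-SelfDom r r≥0 sd Σr≤a =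
    h , (λ u → value (rounded u)) ,
    SelfDom-transfer (λ u → keep-c (rounded u)) (λ u → keep-1 (rounded u)) sd ,
    ≤-trans (sumR-mono V (λ u → below (rounded u))) Σr≤a
    where
    open RoundsDown
    rounded : ∀ u → RoundsDown (r u) (proj₁ (roundDown (r u) (r≥0 u)))
    rounded u = proj₂ (roundDown (r u) (r≥0 u))
    h : Fin V → R
    h u = proj₁ (roundDown (r u) (r≥0 u))

  -- Step 2: raising values to 1 keeps a function {0, 1, c}-valued and
  -- dominating, since raise k h u is h u or 1, and c ≤ 1.
  raise-preserves : ∀ k (h : Fin V → R) → (∀ u → Value01c (h u)) → SelfDom h →
                    (∀ u → Value01c (raise k h u)) × SelfDom (raise k h)
  raise-preserves k h vals sd =
    values , SelfDom-transfer (raised-above (inj₁ c<1)) (raised-above ≤-refl) sd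
    where
    values : ∀ u → Value01c (raise k h u)
    values u with raise k h u | raise-cases k h u
    ... | _ | inj₁ refl = vals u
    ... | _ | inj₂ refl = inj₂ (inj₁ refl)
    raised-above : ∀ {z} → z ≤ᵣ 1# → ∀ u → z ≤ᵣ h u → z ≤ᵣ raise k h u
    raised-above z≤1 u z≤hᵤ with raise k h u | raise-cases k h u
    ... | _ | inj₁ refl = z≤hᵤ
    ... | _ | inj₂ refl = z≤1

  raise-into-range : ∀ a → a ≤ᵣ fromℕ ℝ V → (h : Fin V → R) →
    (∀ u → Value01c (h u)) → SelfDom h → sumR V h ≤ᵣ a →
    ∃ λ k → _-_ ℝ a 1# < sumR V (raise k h) × sumR V (raise k h) ≤ᵣ a
  raise-into-range a a≤V h vals sd Σh≤a
    with discrete-ivt (_-_ ℝ a 1#) V (λ k → sumR V (raise k h))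
           (subst (sumR V h ≤ᵣ_) (≡-sym a-1+1≡a) Σh≤a)
           (λ k → raise-step 0<1 V k h (λ u → Value01c⇒≥0 (vals u)))
           (<-≤-trans a-1<a (≤-trans a≤V (inj₂ (≡-sym (raise-all V h)))))
    where
    a-1+1≡a : _-_ ℝ a 1# + 1# ≡ a
    a-1+1≡a = ∸-+-cancel a 1#
    a-1<a : _-_ ℝ a 1# < a
    a-1<a = subst (_-_ ℝ a 1# <_) a-1+1≡a (<-+1 0<1 (_-_ ℝ a 1#))
  ... | k , a-1<sₖ , sₖ≤a = k , a-1<sₖ , subst (sumR V (raise k h) ≤ᵣ_) (∸-+-cancel a 1#) sₖ≤a

  minimum-rounded : ∀ a (γ : Ext ℝ) → IsGammaC ℝ G c γ → _≤ₑ_ ℝ γ (fin a) →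
    Σ (Fin V → R) λ h → (∀ u → Value01c (h u)) × SelfDom h × sumR V h ≤ᵣ a
  minimum-rounded a γ ((g , (adm , sd) , wg≡γ) , _) γ≤a
    with bounded⇒finite V g adm wg≤a
    where
    wg≤a : _≤ₑ_ ℝ (sumₑ ℝ V g) (fin a)
    wg≤a = subst (λ w → _≤ₑ_ ℝ w (fin a)) (≡-sym wg≡γ) γ≤a
  ... | r , g≡r , r≥0 =
    round-SelfDom r r≥0 (SelfDom-fromExt r g≡r sd)
      (fin≤fin⁻¹ (subst (λ w → _≤ₑ_ ℝ w (fin a)) (trans (≡-sym wg≡γ) (sumₑ-fin V r g≡r)) γ≤a))

  γ≤a⇒weight-in-range : ∀ a → a ≤ᵣ fromℕ ℝ V → (γ : Ext ℝ) →
    IsGammaC ℝ G c γ → _≤ₑ_ ℝ γ (fin a) →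
    ∃ λ f → Values01c ℝ G c f × IsSDF ℝ G c f
          × _<ₑ_ ℝ (fin (_-_ ℝ a 1#)) (weight ℝ G f)
          × _≤ₑ_ ℝ (weight ℝ G f) (fin a)
  γ≤a⇒weight-in-range a a≤V γ isγ γ≤a with minimum-rounded a γ isγ γ≤a
  ... | h , vals , sd , Σh≤a with raise-into-range a a≤V h vals sd Σh≤a
  ...   | k , a-1<w , w≤a with raise-preserves k h vals sd
  ...     | vals' , sd' with toSDF (raise k h) vals' sd'
  ...       | values , sdf =
    (λ u → fin (raise k h u)) , values , sdf ,
    subst (_<ₑ_ ℝ (fin (_-_ ℝ a 1#))) (≡-sym weight≡) (fin<fin a-1<w) ,
    subst (λ w → _≤ₑ_ ℝ w (fin a)) (≡-sym weight≡) (fin≤fin w≤a)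
    where
    weight≡ : sumₑ ℝ V (λ u → fin (raise k h u)) ≡ fin (sumR V (raise k h))
    weight≡ = sumₑ-fin V (raise k h) (λ _ → refl)

lemma2p1 : (ℝ : RealField) → let open RealField ℝ in
           (a c : R) → 0# < a → 0# < c → c < 1# →
           (G : Graph) → _≤_ ℝ a (fromℕ ℝ (n G)) →
           (γ : Ext ℝ) → IsGammaC ℝ G c γ →
           (_≤ₑ_ ℝ γ (fin a) ⇔
             (∃ λ f → Values01c ℝ G c f × IsSDF ℝ G c f
                    × _<ₑ_ ℝ (fin (_-_ ℝ a 1#)) (weight ℝ G f)
                    × _≤ₑ_ ℝ (weight ℝ G f) (fin a)))
lemma2p1 ℝ a c _ 0<c c<1 G a≤n γ isγ =
  mk⇔ (SelfDomination.γ≤a⇒weight-in-range ℝ c 0<c c<1 G a a≤n γ isγ)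
      (λ { (f , _ , sdf , _ , w≤a) → OrderedFieldFacts.≤ₑ-trans ℝ (proj₂ isγ f sdf) w≤a })
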